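{- If $G = (V,E)$ is a graph with girth at least $9$ and minimum degree $\delta \geq 3$, then $cc(G^2-E)\geq \min\{2\delta,\gamma(G^2-E)\}$.
   Context: All graphs are finite, reflexive and connected. In the Cops and Attacking Robbers game, play is as in Cops and Robbers, except that if the robber moves onto a vertex occupied by a cop, one such cop is removed from the game; $cc(G)$ denotes the attacking cop number of $G$, the least number of cops that have a strategy guaranteeing capture of the robber in this game on $G$. $G^2$ is the square of $G$ (add an edge between every pair of vertices at distance $2$ in $G$), so $G^2-E$ has an edge $uv$ iff $\mathrm{dist}_G(u,v)=2$. $\gamma$ is the domination number. -}

module Defs where

open import Data.Nat using (ℕ; zero; suc; _+_; _*_; _≤_; _⊓_)
open import Data.Bool using (Bool; true; false; if_then_else_)
open import Data.Fin using (Fin; _≟_)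
open import Data.Fin.Base using ()
open import Data.List using (List; []; _∷_; length; _++_; allFin)
open import Data.List.Membership.Propositional using (_∈_)
open import Data.List.Relation.Unary.Unique.Propositional using (Unique)
open import Data.List.Relation.Binary.Pointwise using (Pointwise)
open import Data.Product using (Σ; ∃; _×_; _,_)
open import Data.Sum using (_⊎_)
open import Data.Empty using (⊥)
open import Data.Unit using (⊤)
open import Relation.Nullary using (¬_)
open import Relation.Nullary.Decidable using (⌊_⌋)
open import Relation.Binary.PropositionalEquality using (_≡_)

-- Finite simple graphs on vertex set Fin n (loops are implicit: every
-- vertex may "stay put" in the game, i.e. graphs are reflexive).

data Walk {n : ℕ} (E : Fin n → Fin n → Bool) : Fin n → Fin n → Set where
  here : ∀ {u} → Walk E u u
  step : ∀ {u w v} → E u w ≡ true → Walk E w v → Walk E u v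

record Graph (n : ℕ) : Set where
  field
    E         : Fin n → Fin n → Bool
    E-sym     : ∀ u v → E u v ≡ E v u
    E-irrefl  : ∀ v → E v v ≡ false
    connected : ∀ u v → Walk E u v
open Graph public

module _ {n : ℕ} (G : Graph n) where

  countTrue : List (Fin n) → (Fin n → Bool) → ℕ
  countTrue []       f = 0
  countTrue (x ∷ xs) f = (if f x then 1 else 0) + countTrue xs f

  degree : Fin n → ℕ
  degree v = countTrue (allFin n) (E G v)

  IsMinDegree : ℕ → Set
  IsMinDegree d = (∃ λ v → degree v ≡ d) × (∀ v → d ≤ degree v)

  IsPathList : List (Fin n) → Set
  IsPathList []           = ⊤
  IsPathList (x ∷ [])     = ⊤
  IsPathList (x ∷ y ∷ xs) = (E G x y ≡ true) × IsPathList (y ∷ xs)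

  IsCycle : List (Fin n) → Set
  IsCycle []       = ⊥
  IsCycle (x ∷ xs) = (3 ≤ length (x ∷ xs)) × Unique (x ∷ xs)
                     × IsPathList (x ∷ xs ++ x ∷ [])

  GirthAtLeast : ℕ → Set
  GirthAtLeast g = ∀ cs → IsCycle cs → g ≤ length cs

  -- G² − E : u v adjacent iff dist_G(u,v) = 2
  Dist2 : Fin n → Fin n → Set
  Dist2 u v = ¬ (u ≡ v) × (E G u v ≡ false)
              × (∃ λ w → (E G u w ≡ true) × (E G w v ≡ true))

module _ {n : ℕ} (R : Fin n → Fin n → Set) where

  Dominating : List (Fin n) → Set
  Dominating D = ∀ v → (v ∈ D) ⊎ (∃ λ u → (u ∈ D) × R u v)

  IsDominationNumber : ℕ → Set
  IsDominationNumber g =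
    (∃ λ D → Dominating D × length D ≡ g) ×
    (∀ D → Dominating D → g ≤ length D)

module _ {n : ℕ} (R : Fin n → Fin n → Set) where

  Move : Fin n → Fin n → Set
  Move u v = (u ≡ v) ⊎ R u v

  count : Fin n → List (Fin n) → ℕ
  count r []       = 0
  count r (c ∷ cs) = (if ⌊ c ≟ r ⌋ then 1 else 0) + count r cs

  removeOne : Fin n → List (Fin n) → List (Fin n)
  removeOne r []       = []
  removeOne r (c ∷ cs) = if ⌊ c ≟ r ⌋ then cs else c ∷ removeOne r cs

  mutual
    -- CopsWin cs r : it is the cops' turn, cops at cs (a multiset),
    -- robber at r (not on a cop); the cops can force capture in
    -- finitely many rounds (inductive = well-founded strategy tree).
    data CopsWin (cs : List (Fin n)) (r : Fin n) : Set where
      cmove : (cs' : List (Fin n)) → Pointwise Move cs cs' →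
              ((r ∈ cs') ⊎ (∀ r' → Move r r' → AfterRobber cs' r')) →
              CopsWin cs r

    data AfterRobber (cs : List (Fin n)) (r : Fin n) : Set where
      -- robber moved onto ≥ 2 cops: one cop is removed, another
      -- remains on the robber's vertex, so the robber is captured
      caught   : 2 ≤ count r cs → AfterRobber cs r
      -- robber attacks a single cop: that cop is removed
      attacked : count r cs ≡ 1 → CopsWin (removeOne r cs) r →
                 AfterRobber cs r
      free     : count r cs ≡ 0 → CopsWin cs r → AfterRobber cs r

  CopsWinWith : ℕ → Set
  CopsWinWith k = ∃ λ cs → (length cs ≡ k) × (∀ r → (r ∈ cs) ⊎ CopsWin cs r)

  IsAttackingCopNumber : ℕ → Set
  IsAttackingCopNumber c = CopsWinWith c × (∀ k → CopsWinWith k → c ≤ k)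

{-# OPTIONS --safe #-}
module Submission where

-- The robber starts on a vertex that the fewer than γ cops do not dominate in G² − E, and keeps
-- the invariant that no cop can reach his vertex r in one move. Each of his moves goes from r
-- through a neighbour x of r to a neighbour y ≠ r of x; a cop guards the branch x if it can move
-- onto such a y. Girth ≥ 9 forbids a cop not on r from guarding two branches, so fewer than 2δ
-- cops leave some branch with at most one guard. As δ ≥ 3, x has neighbours y₁ ≠ y₂ other than
-- r, and the robber moves to one the guard cannot reach, unless it reaches both: then girth ≥ 7
-- puts the guard on a neighbour of x, and the robber attacks it there, where no other cop can
-- reach him.

open import Defs
open import Data.Bool using (true; false)
import Data.Bool as Bool
open import Data.Bool.Properties using (¬-not)
open import Data.Empty using (⊥; ⊥-elim)
open import Data.Fin using (Fin; _≟_)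
open import Data.Fin.Properties using (any?; ¬∀⟶∃¬)
open import Data.List using (List; []; _∷_; _++_; length; filter; allFin)
open import Data.List.Properties using (length-++; filter-accept)
open import Data.List.Membership.Propositional using (_∈_; _∉_; find; lose)
open import Data.List.Membership.Propositional.Properties
  using (∈-∃++; ∈-++⁺ʳ; ∈-filter⁺; ∈-filter⁻)
open import Data.List.Relation.Unary.All as All using (All; []; _∷_)
open import Data.List.Relation.Unary.All.Properties using (¬Any⇒All¬; ++⁻ˡ; ++⁻ʳ)
open import Data.List.Relation.Unary.Any as Any using (here; there)
open import Data.List.Relation.Unary.AllPairs using ([]; _∷_)
open import Data.List.Relation.Unary.Unique.Propositional using (Unique)
open import Data.List.Relation.Unary.Unique.Propositional.Properties
  using (allFin⁺) renaming (filter⁺ to Unique-filter⁺)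
open import Data.List.Relation.Binary.Pointwise using (Pointwise; []; _∷_)
open import Data.List.Relation.Binary.Pointwise.Properties using (Pointwise-length)
open import Data.Nat using (ℕ; suc; _+_; _*_; _≤_; _<_; _⊓_; z≤n; s≤s; s≤s⁻¹; z<s; _≤?_)
open import Data.Nat.Properties
  using (≤-refl; ≤-trans; n≤1+n; ≤-<-trans; <-irrefl; <⇒≱; ≰⇒>; ≮⇒≥;
         +-suc; +-mono-≤; *-monoʳ-≤; *-comm;
         m<m+n; m<n⇒n≢0; m≤n⊓o⇒m≤n; m≤n⊓o⇒m≤o; module ≤-Reasoning)
open import Data.Product using (∃; ∃₂; _×_; _,_; proj₁; proj₂)
open import Data.Sum using (_⊎_; inj₁; inj₂)
open import Data.Unit using (⊤; tt)
open import Function using (_∘_; case_of_)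
open import Relation.Nullary using (¬_; Dec; yes; no; contradiction; ¬?)
open import Relation.Nullary.Decidable using (_×-dec_; _⊎-dec_; from-yes)
open import Relation.Unary using (Decidable)
open import Relation.Binary.PropositionalEquality
  using (_≡_; _≢_; refl; sym; trans; cong; subst; ≢-sym)

module _ {A : Set} where

  Unique-++-∷⁻ : ∀ xs {v ys} → Unique {A = A} (xs ++ v ∷ ys) → Unique (v ∷ xs)
  Unique-++-∷⁻ []       _           = [] ∷ []
  Unique-++-∷⁻ (a ∷ xs) (a∉ ∷ xs!) with Unique-++-∷⁻ xs xs!
  ... | v∉xs ∷ xs!′ = (≢-sym (All.head (++⁻ʳ xs a∉)) ∷ v∉xs) ∷ (++⁻ˡ xs a∉ ∷ xs!′)

  Pointwise-∈⁻ : ∀ {R : A → A → Set} {xs ys y} → Pointwise R xs ys → y ∈ ys →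
                 ∃ λ x → x ∈ xs × R x y
  Pointwise-∈⁻ (Rxy ∷ _)   (here refl) = _ , here refl , Rxy
  Pointwise-∈⁻ (_ ∷ xs∼ys) (there y∈ys) with Pointwise-∈⁻ xs∼ys y∈ys
  ... | x , x∈xs , Rxy = x , there x∈xs , Rxy

twoAvoiding : ∀ {n} (r : Fin n) xs → Unique xs → 3 ≤ length xs →
  ∃₂ λ y₁ y₂ → y₁ ∈ xs × y₂ ∈ xs × y₁ ≢ y₂ × y₁ ≢ r × y₂ ≢ r
twoAvoiding r []           _ ()
twoAvoiding r (_ ∷ [])     _ (s≤s ())
twoAvoiding r (_ ∷ _ ∷ []) _ (s≤s (s≤s ()))
twoAvoiding r (a ∷ b ∷ c ∷ _) ((a≢b ∷ a≢c ∷ _) ∷ (b≢c ∷ _) ∷ _) _ with a ≟ r | b ≟ r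
... | yes refl | _        = b , c , there (here refl) , there (there (here refl)) ,
                            b≢c , ≢-sym a≢b , ≢-sym a≢c
... | no a≢r   | yes refl = a , c , here refl , there (there (here refl)) , a≢c , a≢r , ≢-sym b≢c
... | no a≢r   | no b≢r   = a , b , here refl , there (here refl) , a≢b , a≢r , b≢r

module _ {B : Set} {Q : B → Set} (Q? : Decidable Q) where

  length-filter+filter-∁ : ∀ L → length (filter Q? L) + length (filter (¬? ∘ Q?) L) ≡ length L
  length-filter+filter-∁ []      = refl
  length-filter+filter-∁ (b ∷ L) with Q? b
  ... | yes _ = cong suc (length-filter+filter-∁ L)
  ... | no  _ = trans (+-suc _ _) (cong suc (length-filter+filter-∁ L))

  filter-filter-∁ : ∀ {P : B → Set} (P? : Decidable P) L → (∀ {b} → b ∈ L → P b → ¬ Q b) →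
                    filter P? (filter (¬? ∘ Q?) L) ≡ filter P? L
  filter-filter-∁ P? []      _        = refl
  filter-filter-∁ P? (b ∷ L) disjoint with Q? b
  ... | yes Qb with P? b
  ...   | yes Pb = contradiction Qb (disjoint (here refl) Pb)
  ...   | no  _  = filter-filter-∁ P? L (disjoint ∘ there)
  filter-filter-∁ P? (b ∷ L) disjoint | no _ with P? b
  ...   | yes _ = cong (b ∷_) (filter-filter-∁ P? L (disjoint ∘ there))
  ...   | no  _ = filter-filter-∁ P? L (disjoint ∘ there)

module _ {A B : Set} {P : A → B → Set} (P? : ∀ x → Decidable (P x)) where

  disjointClasses-size : ∀ k xs L → Unique xs →
    (∀ {x x′ b} → x ∈ xs → x′ ∈ xs → x ≢ x′ → b ∈ L → P x b → P x′ b → ⊥) →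
    (∀ {x} → x ∈ xs → k ≤ length (filter (P? x) L)) →
    length xs * k ≤ length L
  disjointClasses-size k []       L _           _        _     = z≤n
  disjointClasses-size k (x ∷ xs) L (x∉xs ∷ xs!) disjoint large = begin
    k + length xs * k                                        ≤⟨ +-mono-≤ (large (here refl)) rest ⟩
    length (filter (P? x) L) + length (filter (¬? ∘ P? x) L) ≡⟨ length-filter+filter-∁ (P? x) L ⟩
    length L                                                 ∎
    where
    open ≤-Reasoning
    rest : length xs * k ≤ length (filter (¬? ∘ P? x) L)
    rest = disjointClasses-size k xs _ xs!
      (λ x₁∈ x₂∈ x₁≢x₂ b∈ → disjoint (there x₁∈) (there x₂∈) x₁≢x₂ (proj₁ (∈-filter⁻ _ b∈)))
      (λ x′∈xs → subst (k ≤_)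
        (cong length (sym (filter-filter-∁ (P? x) (P? _) L
          (disjoint (there x′∈xs) (here refl) (≢-sym (All.lookup x∉xs x′∈xs))))))
        (large (there x′∈xs)))

-- `count` and `removeOne` do not use the relation R; it only fixes their module parameter.
module _ {n : ℕ} (R : Fin n → Fin n → Set) where

  count≢0⇒∈ : ∀ {y} L → count R y L ≢ 0 → y ∈ L
  count≢0⇒∈     []      c≢0 = contradiction refl c≢0
  count≢0⇒∈ {y} (c ∷ L) c≢0 with c ≟ y
  ... | yes refl = here refl
  ... | no  _    = there (count≢0⇒∈ L c≢0)

  ∈⇒count≢0 : ∀ {y} L → y ∈ L → count R y L ≢ 0
  ∈⇒count≢0 {y} (c ∷ L) y∈ with c ≟ y
  ∈⇒count≢0 (c ∷ L) _           | yes _   = λ ()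
  ∈⇒count≢0 (c ∷ L) (here refl) | no c≢y = contradiction refl c≢y
  ∈⇒count≢0 (c ∷ L) (there y∈L) | no _   = ∈⇒count≢0 L y∈L

  count≥2⇒∈-removeOne : ∀ {y} L → 2 ≤ count R y L → y ∈ removeOne R y L
  count≥2⇒∈-removeOne {y} (c ∷ L) two with c ≟ y
  ... | yes _ = count≢0⇒∈ L (m<n⇒n≢0 (s≤s⁻¹ two))
  ... | no  _ = there (count≥2⇒∈-removeOne L two)

  ∈-removeOne⁺ : ∀ {p y} L → p ∈ L → p ≢ y → p ∈ removeOne R y L
  ∈-removeOne⁺ {y = y} (c ∷ L) p∈ p≢y with c ≟ y
  ∈-removeOne⁺ (c ∷ L) (here refl) p≢y | yes c≡y = contradiction c≡y p≢y
  ∈-removeOne⁺ (c ∷ L) (there p∈) _    | yes _   = p∈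
  ∈-removeOne⁺ (c ∷ L) (here refl) _   | no  _   = here refl
  ∈-removeOne⁺ (c ∷ L) (there p∈) p≢y  | no  _   = there (∈-removeOne⁺ L p∈ p≢y)

  length-removeOne : ∀ y L → length (removeOne R y L) ≤ length L
  length-removeOne y []      = z≤n
  length-removeOne y (c ∷ L) with c ≟ y
  ... | yes _ = n≤1+n (length L)
  ... | no  _ = s≤s (length-removeOne y L)

  removeOne-head : ∀ y L → removeOne R y (y ∷ L) ≡ L
  removeOne-head y L with y ≟ y
  ... | yes _   = refl
  ... | no  y≢y = contradiction refl y≢y

  removeOne-≢ : ∀ {c y} L → c ≢ y → removeOne R y (c ∷ L) ≡ c ∷ removeOne R y L
  removeOne-≢ {c} {y} L c≢y with c ≟ y
  ... | yes c≡y = contradiction c≡y c≢y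
  ... | no  _   = refl

  filter-removeOne : ∀ {P : Fin n → Set} (P? : Decidable P) {y} L → P y →
                     filter P? (removeOne R y L) ≡ removeOne R y (filter P? L)
  filter-removeOne P?     []      _  = refl
  filter-removeOne P? {y} (c ∷ L) Py with c ≟ y
  ... | yes refl = sym (trans (cong (removeOne R c) (filter-accept P? Py)) (removeOne-head c _))
  ... | no  c≢y with P? c
  ...   | yes _ = trans (cong (c ∷_) (filter-removeOne P? L Py)) (sym (removeOne-≢ _ c≢y))
  ...   | no  _ = filter-removeOne P? L Py

  atMostOne : ∀ {P : Fin n → Set} (P? : Decidable P) L → length (filter P? L) ≤ 1 →
              (∀ {p} → p ∈ L → ¬ P p) ⊎
              ∃ λ p₀ → p₀ ∈ L × P p₀ × (∀ {p} → p ∈ removeOne R p₀ L → ¬ P p)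
  atMostOne P? L few with filter P? L in eq
  ... | [] = inj₁ λ p∈L Pp → case subst (_ ∈_) eq (∈-filter⁺ P? p∈L Pp) of λ ()
  ... | p₀ ∷ [] with ∈-filter⁻ P? (subst (p₀ ∈_) (sym eq) (here refl))
  ...   | p₀∈L , Pp₀ = inj₂ (p₀ , p₀∈L , Pp₀ , λ p∈ Pp → case emptied (∈-filter⁺ P? p∈ Pp) of λ ())
    where
    emptied : ∀ {p} → p ∈ filter P? (removeOne R p₀ L) → p ∈ []
    emptied p∈ = subst (_ ∈_) (trans (filter-removeOne P? L Pp₀)
                   (trans (cong (removeOne R p₀) eq) (removeOne-head p₀ []))) p∈
  atMostOne P? L (s≤s ()) | _ ∷ _ ∷ _

module _ {n : ℕ} (G : Graph n) where

  open import Data.List.Membership.DecPropositional (_≟_ {n}) using (_∈?_)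

  infix 4 _~_
  _~_ : Fin n → Fin n → Set
  u ~ v = E G u v ≡ true

  ~-sym : ∀ {u v} → u ~ v → v ~ u
  ~-sym {u} {v} u~v = trans (E-sym G v u) u~v

  ~⇒≢ : ∀ {u v} → u ~ v → u ≢ v
  ~⇒≢ {u} u~u refl = case trans (sym u~u) (E-irrefl G u) of λ ()

  NonBacktracking : List (Fin n) → Set
  NonBacktracking (a ∷ b ∷ c ∷ w) = a ≢ c × NonBacktracking (b ∷ c ∷ w)
  NonBacktracking _               = ⊤

  IsPathList-tail : ∀ {v} w → IsPathList G (v ∷ w) → IsPathList G w
  IsPathList-tail []      _          = tt
  IsPathList-tail (_ ∷ _) (_ , path) = path

  NonBacktracking-tail : ∀ {v} w → NonBacktracking (v ∷ w) → NonBacktracking w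
  NonBacktracking-tail []          _        = tt
  NonBacktracking-tail (_ ∷ [])    _        = tt
  NonBacktracking-tail (_ ∷ _ ∷ _) (_ , nb) = nb

  IsPathList-prefix : ∀ xs {a ys} → IsPathList G (xs ++ a ∷ ys) → IsPathList G (xs ++ a ∷ [])
  IsPathList-prefix []           _          = tt
  IsPathList-prefix (_ ∷ [])     (e , _)    = e , tt
  IsPathList-prefix (_ ∷ _ ∷ xs) (e , path) = e , IsPathList-prefix (_ ∷ xs) path

  closedWalk-IsCycle : ∀ v pre {post} →
    IsPathList G (v ∷ pre ++ v ∷ post) → NonBacktracking (v ∷ pre ++ v ∷ post) →
    Unique (pre ++ v ∷ post) → IsCycle G (v ∷ pre)
  closedWalk-IsCycle v []            (v~v , _) _         _    = contradiction refl (~⇒≢ v~v)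
  closedWalk-IsCycle v (_ ∷ [])      _         (v≢v , _) _    = contradiction refl v≢v
  closedWalk-IsCycle v (a ∷ b ∷ pre) path      _         pre! =
    s≤s (s≤s (s≤s z≤n)) , Unique-++-∷⁻ (a ∷ b ∷ pre) pre! ,
    IsPathList-prefix (v ∷ a ∷ b ∷ pre) path

  nonBacktracking-head∉ : ∀ {g} → GirthAtLeast G g → ∀ v w →
    IsPathList G (v ∷ w) → NonBacktracking (v ∷ w) → Unique w → length (v ∷ w) ≤ g →
    All (v ≢_) w
  nonBacktracking-head∉ {g} girth v w path nb w! short with v ∈? w
  ... | no v∉w = ¬Any⇒All¬ w v∉w
  ... | yes v∈w with pre , post , refl ← ∈-∃++ v∈w =
    ⊥-elim (<-irrefl refl (begin-strict
      g                                   ≤⟨ girth (v ∷ pre) (closedWalk-IsCycle v pre path nb w!) ⟩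
      suc (length pre)                    <⟨ s≤s (m<m+n (length pre) z<s) ⟩
      suc (length pre + length (v ∷ post)) ≡⟨ cong suc (length-++ pre) ⟨
      length (v ∷ pre ++ v ∷ post)        ≤⟨ short ⟩
      g                                   ∎))
    where open ≤-Reasoning

  nonBacktracking-Unique : ∀ {g} → GirthAtLeast G g → ∀ w →
    IsPathList G w → NonBacktracking w → length w ≤ g → Unique w
  nonBacktracking-Unique girth []      _    _  _     = []
  nonBacktracking-Unique girth (v ∷ w) path nb short =
    nonBacktracking-head∉ girth v w path nb w! short ∷ w!
    where
    w! = nonBacktracking-Unique girth w (IsPathList-tail w path) (NonBacktracking-tail w nb)
           (≤-trans (n≤1+n _) short)

  noShortClosedWalk : ∀ {g} → GirthAtLeast G g → ∀ v xs →
    IsPathList G (v ∷ xs ++ v ∷ []) → NonBacktracking (v ∷ xs ++ v ∷ []) →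
    length (v ∷ xs ++ v ∷ []) ≤ g → ⊥
  noShortClosedWalk girth v xs path nb short
    with v∉ ∷ _ ← nonBacktracking-Unique girth (v ∷ xs ++ v ∷ []) path nb short =
    All.lookup v∉ (∈-++⁺ʳ xs (here refl)) refl

  GirthAtLeast-weaken : ∀ {g h} → h ≤ g → GirthAtLeast G g → GirthAtLeast G h
  GirthAtLeast-weaken h≤g girth cs cycle = ≤-trans h≤g (girth cs cycle)

  Dist2-via : GirthAtLeast G 4 → ∀ {r x y} → r ~ x → x ~ y → y ≢ r → Dist2 G r y
  Dist2-via girth {r} {x} {y} r~x x~y y≢r =
    ≢-sym y≢r ,
    ¬-not (λ r~y → noShortClosedWalk girth r (x ∷ y ∷ [])
      (r~x , x~y , ~-sym r~y , tt) (≢-sym y≢r , ~⇒≢ (~-sym r~x) , tt) ≤-refl) ,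
    x , r~x , x~y

  Dist2? : ∀ u v → Dec (Dist2 G u v)
  Dist2? u v = ¬? (u ≟ v) ×-dec (E G u v Bool.≟ false)
               ×-dec any? (λ w → (E G u w Bool.≟ true) ×-dec (E G w v Bool.≟ true))

  Move? : ∀ u v → Dec (Move (Dist2 G) u v)
  Move? u v = (u ≟ v) ⊎-dec Dist2? u v

  threatensTwo⇒adjacent : GirthAtLeast G 7 → ∀ {x y₁ y₂ p} → x ~ y₁ → x ~ y₂ → y₁ ≢ y₂ →
    Move (Dist2 G) p y₁ → Move (Dist2 G) p y₂ → x ~ p
  threatensTwo⇒adjacent girth x~y₁ _    _ (inj₁ refl) _           = x~y₁
  threatensTwo⇒adjacent girth _    x~y₂ _ (inj₂ _)    (inj₁ refl) = x~y₂
  threatensTwo⇒adjacent girth {x} {y₁} {y₂} {p} x~y₁ x~y₂ y₁≢y₂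
    (inj₂ (p≢y₁ , _ , w₁ , p~w₁ , w₁~y₁)) (inj₂ (p≢y₂ , _ , w₂ , p~w₂ , w₂~y₂))
    with w₁ ≟ x | w₂ ≟ x
  ... | yes refl | _        = ~-sym p~w₁
  ... | no _     | yes refl = ~-sym p~w₂
  ... | no w₁≢x  | no w₂≢x  = ⊥-elim (noShortClosedWalk girth p (w₁ ∷ y₁ ∷ x ∷ y₂ ∷ w₂ ∷ [])
          (p~w₁ , w₁~y₁ , ~-sym x~y₁ , x~y₂ , ~-sym w₂~y₂ , ~-sym p~w₂ , tt)
          (p≢y₁ , w₁≢x , y₁≢y₂ , ≢-sym w₂≢x , ≢-sym p≢y₂ , tt) ≤-refl)

  Guards : (r x p : Fin n) → Set
  Guards r x p = ∃ λ y → x ~ y × y ≢ r × Move (Dist2 G) p y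

  Guards? : ∀ r x p → Dec (Guards r x p)
  Guards? r x p = any? λ y → (E G x y Bool.≟ true) ×-dec ¬? (y ≟ r) ×-dec Move? p y

  -- Non-backtracking walks r x p (once p ≢ r) and r x y w p.
  data ShortRoute (r x p : Fin n) : Set where
    direct : x ~ p → ShortRoute r x p
    around : ∀ {y w} → x ~ y → y ≢ r → y ~ w → w ≢ x → w ~ p → p ≢ y → ShortRoute r x p

  Guards⇒ShortRoute : ∀ {r x p} → Guards r x p → ShortRoute r x p
  Guards⇒ShortRoute (_ , x~y , _ , inj₁ refl) = direct x~y
  Guards⇒ShortRoute {x = x} (_ , x~y , y≢r , inj₂ (p≢y , _ , w , p~w , w~y)) with w ≟ x
  ... | yes refl = direct (~-sym p~w)
  ... | no  w≢x  = around x~y y≢r (~-sym w~y) w≢x (~-sym p~w) p≢y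

  ShortRoutes-unique : GirthAtLeast G 9 → ∀ {r x x′ p} → r ~ x → r ~ x′ → x ≢ x′ → p ≢ r →
    ShortRoute r x p → ShortRoute r x′ p → ⊥
  ShortRoutes-unique girth {r} {x} {x′} {p} r~x r~x′ x≢x′ p≢r = routes
    where
    directAround : ∀ {x x′} → r ~ x → r ~ x′ → x ≢ x′ → x ~ p → ShortRoute r x′ p → ⊥
    directAround {x} {x′} r~x r~x′ x≢x′ x~p (direct x′~p) =
      noShortClosedWalk girth x (r ∷ x′ ∷ p ∷ [])
        (~-sym r~x , r~x′ , x′~p , ~-sym x~p , tt) (x≢x′ , ≢-sym p≢r , ≢-sym x≢x′ , tt)
        (from-yes (5 ≤? 9))
    directAround {x} {x′} r~x r~x′ x≢x′ x~p (around {y′} {w′} x′~y′ y′≢r y′~w′ w′≢x′ w′~p p≢y′) =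
      noShortClosedWalk girth p (x ∷ r ∷ x′ ∷ y′ ∷ w′ ∷ [])
        (~-sym x~p , ~-sym r~x , r~x′ , x′~y′ , y′~w′ , w′~p , tt)
        (p≢r , x≢x′ , ≢-sym y′≢r , ≢-sym w′≢x′ , ≢-sym p≢y′ , tt)
        (from-yes (7 ≤? 9))

    routes : ShortRoute r x p → ShortRoute r x′ p → ⊥
    routes (direct x~p) route′ = directAround r~x r~x′ x≢x′ x~p route′
    routes route (direct x′~p) = directAround r~x′ r~x (≢-sym x≢x′) x′~p route
    routes (around {y} {w} x~y y≢r y~w w≢x w~p p≢y)
           (around {y′} {w′} x′~y′ y′≢r y′~w′ w′≢x′ w′~p p≢y′) =
      noShortClosedWalk girth p (w ∷ y ∷ x ∷ r ∷ x′ ∷ y′ ∷ w′ ∷ [])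
        (~-sym w~p , ~-sym y~w , ~-sym x~y , ~-sym r~x , r~x′ , x′~y′ , y′~w′ , w′~p , tt)
        (p≢y , w≢x , y≢r , x≢x′ , ≢-sym y′≢r , ≢-sym w′≢x′ , ≢-sym p≢y′ , tt)
        ≤-refl

  Guards-unique : GirthAtLeast G 9 → ∀ {r x x′ p} → r ~ x → r ~ x′ → x ≢ x′ → p ≢ r →
    Guards r x p → Guards r x′ p → ⊥
  Guards-unique girth r~x r~x′ x≢x′ p≢r guards guards′ =
    ShortRoutes-unique girth r~x r~x′ x≢x′ p≢r (Guards⇒ShortRoute guards) (Guards⇒ShortRoute guards′)

  countTrue≡length-filter : ∀ xs f → countTrue G xs f ≡ length (filter (λ w → f w Bool.≟ true) xs)
  countTrue≡length-filter []       f = refl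
  countTrue≡length-filter (x ∷ xs) f with f x
  ... | true  = cong suc (countTrue≡length-filter xs f)
  ... | false = countTrue≡length-filter xs f

  neighbours : Fin n → List (Fin n)
  neighbours v = filter (λ w → E G v w Bool.≟ true) (allFin n)

  length-neighbours : ∀ v → length (neighbours v) ≡ degree G v
  length-neighbours v = sym (countTrue≡length-filter (allFin n) (E G v))

  Unique-neighbours : ∀ v → Unique (neighbours v)
  Unique-neighbours v = Unique-filter⁺ _ (allFin⁺ n)

  ∈-neighbours⁻ : ∀ {v w} → w ∈ neighbours v → v ~ w
  ∈-neighbours⁻ {v} w∈ = proj₂ (∈-filter⁻ (λ w → E G v w Bool.≟ true) {xs = allFin n} w∈)

  twoNeighboursAvoiding : ∀ x r → 3 ≤ degree G x →
    ∃₂ λ y₁ y₂ → x ~ y₁ × x ~ y₂ × y₁ ≢ y₂ × y₁ ≢ r × y₂ ≢ r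
  twoNeighboursAvoiding x r 3≤deg
    with y₁ , y₂ , y₁∈ , y₂∈ , y₁≢y₂ , y₁≢r , y₂≢r
           ← twoAvoiding r (neighbours x) (Unique-neighbours x)
           (subst (3 ≤_) (sym (length-neighbours x)) 3≤deg) =
    y₁ , y₂ , ∈-neighbours⁻ y₁∈ , ∈-neighbours⁻ y₂∈ , y₁≢y₂ , y₁≢r , y₂≢r

  Safe : List (Fin n) → Fin n → Set
  Safe L y = ∀ {p} → p ∈ L → ¬ Move (Dist2 G) p y

  Safe⇒∉ : ∀ {L y} → Safe L y → y ∉ L
  Safe⇒∉ safe y∈L = safe y∈L (inj₁ refl)

  Safe⇒∉-afterMove : ∀ {L L′ r} → Safe L r → Pointwise (Move (Dist2 G)) L L′ → r ∉ L′
  Safe⇒∉-afterMove safe moves r∈L′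
    with _ , p∈L , p→r ← Pointwise-∈⁻ moves r∈L′ = safe p∈L p→r

  undominated-Safe : ∀ {γ} → (∀ D → Dominating (Dist2 G) D → γ ≤ length D) →
    ∀ L → length L < γ → ∃ λ v → Safe L v
  undominated-Safe minimal L L<γ
    with v , undominated ← ¬∀⟶∃¬ n _ (λ v → (v ∈? L) ⊎-dec any? (λ u → (u ∈? L) ×-dec Dist2? u v))
                                      (λ dominating → <⇒≱ L<γ (minimal L dominating)) =
    v , λ where p∈L (inj₁ refl) → undominated (inj₁ p∈L)
                p∈L (inj₂ p–v)  → undominated (inj₂ (_ , p∈L , p–v))

  safeExceptGuard : ∀ {r x y p₀ L} → x ~ y → y ≢ r →
    (∀ {p} → p ∈ removeOne (Dist2 G) p₀ L → ¬ Guards r x p) → ¬ Move (Dist2 G) p₀ y → Safe L y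
  safeExceptGuard {p₀ = p₀} {L} x~y y≢r onlyP₀ p₀↛y {p} p∈L p→y with p ≟ p₀
  ... | yes refl = p₀↛y p→y
  ... | no  p≢p₀ = onlyP₀ (∈-removeOne⁺ (Dist2 G) L p∈L p≢p₀) (_ , x~y , y≢r , p→y)

  module RobberStrategy (girth : GirthAtLeast G 9) {δ} (minDegree : ∀ v → δ ≤ degree G v)
                        (3≤δ : 3 ≤ δ) where

    girth≥4 : GirthAtLeast G 4
    girth≥4 = GirthAtLeast-weaken (from-yes (4 ≤? 9)) girth

    girth≥7 : GirthAtLeast G 7
    girth≥7 = GirthAtLeast-weaken (from-yes (7 ≤? 9)) girth

    -- In the second case Safe forces y to carry a single cop, which the robber's attack removes.
    Good : List (Fin n) → Fin n → Set
    Good L y = Safe L y ⊎ (y ∈ L × Safe (removeOne (Dist2 G) y L) y)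

    escapeThrough : ∀ {r x} L → r ∉ L → r ~ x → length (filter (Guards? r x) L) ≤ 1 →
      ∃ λ y → Dist2 G r y × Good L y
    escapeThrough {r} {x} L r∉L r~x few
      with y₁ , y₂ , x~y₁ , x~y₂ , y₁≢y₂ , y₁≢r , y₂≢r
             ← twoNeighboursAvoiding x r (≤-trans 3≤δ (minDegree x))
      with atMostOne (Dist2 G) (Guards? r x) L few
    ... | inj₁ unguarded = y₁ , Dist2-via girth≥4 r~x x~y₁ y₁≢r ,
                           inj₁ λ p∈L p→y₁ → unguarded p∈L (y₁ , x~y₁ , y₁≢r , p→y₁)
    ... | inj₂ (p₀ , p₀∈L , _ , onlyP₀) with Move? p₀ y₁ | Move? p₀ y₂
    ...   | no p₀↛y₁ | _        = y₁ , Dist2-via girth≥4 r~x x~y₁ y₁≢r ,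
                                  inj₁ (safeExceptGuard x~y₁ y₁≢r onlyP₀ p₀↛y₁)
    ...   | yes _    | no p₀↛y₂ = y₂ , Dist2-via girth≥4 r~x x~y₂ y₂≢r ,
                                  inj₁ (safeExceptGuard x~y₂ y₂≢r onlyP₀ p₀↛y₂)
    ...   | yes p₀→y₁ | yes p₀→y₂ = p₀ , Dist2-via girth≥4 r~x x~p₀ p₀≢r ,
                                    inj₂ (p₀∈L , λ p∈ p→p₀ → onlyP₀ p∈ (p₀ , x~p₀ , p₀≢r , p→p₀))
      where
      x~p₀ = threatensTwo⇒adjacent girth≥7 x~y₁ x~y₂ y₁≢y₂ p₀→y₁ p₀→y₂
      p₀≢r : p₀ ≢ r
      p₀≢r refl = r∉L p₀∈L

    escape : ∀ r L → r ∉ L → length L < 2 * δ → ∃ λ y → Dist2 G r y × Good L y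
    escape r L r∉L short with Any.any? (λ x → length (filter (Guards? r x) L) ≤? 1) (neighbours r)
    ... | yes weak with x , x∈N , few ← find weak = escapeThrough L r∉L (∈-neighbours⁻ x∈N) few
    ... | no ¬weak = ⊥-elim (<⇒≱ short (begin
      2 * δ                     ≤⟨ *-monoʳ-≤ 2 (minDegree r) ⟩
      2 * degree G r            ≡⟨ *-comm 2 (degree G r) ⟩
      degree G r * 2            ≡⟨ cong (_* 2) (length-neighbours r) ⟨
      length (neighbours r) * 2 ≤⟨ disjointClasses-size (Guards? r) 2 (neighbours r) L
                                     (Unique-neighbours r) disjoint (λ x∈N → ≰⇒> (¬weak ∘ lose x∈N)) ⟩
      length L                  ∎))
      where
      open ≤-Reasoning
      disjoint : ∀ {x x′ p} → x ∈ neighbours r → x′ ∈ neighbours r → x ≢ x′ → p ∈ L →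
                 Guards r x p → Guards r x′ p → ⊥
      disjoint x∈N x′∈N x≢x′ p∈L = Guards-unique girth (∈-neighbours⁻ x∈N) (∈-neighbours⁻ x′∈N) x≢x′
                                     λ { refl → r∉L p∈L }

    mutual
      robberEvades : ∀ L r → length L < 2 * δ → Safe L r → ¬ CopsWin (Dist2 G) L r
      robberEvades L r short safe (cmove L′ moves (inj₁ r∈L′)) = Safe⇒∉-afterMove safe moves r∈L′
      robberEvades L r short safe (cmove L′ moves (inj₂ respond)) =
        let short′ = subst (_< 2 * δ) (Pointwise-length moves) short
            y , r–y , good = escape r L′ (Safe⇒∉-afterMove safe moves) short′
        in robberSurvives L′ y short′ good (respond y (inj₂ r–y))

      robberSurvives : ∀ L y → length L < 2 * δ → Good L y → ¬ AfterRobber (Dist2 G) L y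
      robberSurvives L y short (inj₁ safe) (caught two) =
        Safe⇒∉ safe (count≢0⇒∈ (Dist2 G) L (m<n⇒n≢0 two))
      robberSurvives L y short (inj₁ safe) (attacked one _) =
        Safe⇒∉ safe (count≢0⇒∈ (Dist2 G) L (subst (_≢ 0) (sym one) λ ()))
      robberSurvives L y short (inj₁ safe) (free _ win) = robberEvades L y short safe win
      robberSurvives L y short (inj₂ (_ , safe)) (caught two) =
        Safe⇒∉ safe (count≥2⇒∈-removeOne (Dist2 G) L two)
      robberSurvives L y short (inj₂ (_ , safe)) (attacked _ win) =
        robberEvades (removeOne (Dist2 G) y L) y (≤-<-trans (length-removeOne (Dist2 G) y L) short) safe win
      robberSurvives L y short (inj₂ (y∈L , _)) (free none _) = ∈⇒count≢0 (Dist2 G) L y∈L none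

    fewCopsLose : ∀ {γ} → (∀ D → Dominating (Dist2 G) D → γ ≤ length D) →
      ∀ cops → length cops < 2 * δ → length cops < γ → ¬ (∀ r → r ∈ cops ⊎ CopsWin (Dist2 G) cops r)
    fewCopsLose minimal cops short fewerThanγ copsWin
      with v , safe ← undominated-Safe minimal cops fewerThanγ with copsWin v
    ... | inj₁ v∈cops = Safe⇒∉ safe v∈cops
    ... | inj₂ win    = robberEvades cops v short safe win

mainTheorem8 : ∀ {n : ℕ} (G : Graph n) (δ γ c : ℕ) →
    GirthAtLeast G 9 →
    IsMinDegree G δ → 3 ≤ δ →
    IsDominationNumber (Dist2 G) γ →
    IsAttackingCopNumber (Dist2 G) c →
    (2 * δ) ⊓ γ ≤ c
mainTheorem8 G δ γ c girth (_ , minDegree) 3≤δ (_ , minimal) ((cops , refl , copsWin) , _) =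
  ≮⇒≥ λ few → RobberStrategy.fewCopsLose G girth minDegree 3≤δ minimal cops
                (m≤n⊓o⇒m≤n (2 * δ) γ few) (m≤n⊓o⇒m≤o (2 * δ) γ few) copsWin
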